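{- Let $G=(V,E)$ be a connected graph and $f(S)=\max\{|\mathcal{I}|:\mathcal{I}\subseteq E \text{ acyclic}, \text{ every } e\in \mathcal{I} \text{ has an endpoint in } S\}$ for $S\subseteq V$. Run the greedy algorithm on $(V,f)$ with chosen vertices $i_1,\dots,i_l$ and $W_r=\{i_1,\dots,i_r\}$, $W_0=\emptyset$, and build edge sets $\emptyset=S_0\subseteq S_1\subseteq\dots\subseteq S_l$ where each $S_r$ is an acyclic set of $f(W_r)$ edges each having an endpoint in $W_r$, obtained from $S_{r-1}$ by adding $f(W_r)-f(W_{r-1})$ edges. Let $rank(i_r)=r$ for $1\le r\le l$, and assign to the vertices not chosen by the greedy algorithm the ranks $l+1,\dots,|V|$ in an arbitrary fixed order. If an edge $(i_r,x)$ belongs to $S_r\setminus S_{r-1}$ (i.e. it is added by the greedy construction at stage $r$), then $rank(x)>r$.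
   Context: Greedy algorithm on $(V,f)$: start with $S=\emptyset$; while $f(S)<f(V)$, choose $i\in V\setminus S$ maximizing $f(S\cup\{i\})-f(S)$ (ties broken arbitrarily) and set $S:=S\cup\{i\}$; $i_1,\dots,i_l$ are the chosen vertices in order. An edge set is acyclic if it contains no cycle of $G$. -}

module Defs where

open import Data.Nat using (ℕ; zero; suc; _≤_; _<_)
open import Data.Fin using (Fin; toℕ) renaming (zero to fz; suc to fs)
open import Data.Fin.Subset using (Subset; _∈_; _∉_; _∪_; ⁅_⁆; ⋃; ∣_∣; ⊤; ⊥; _⊆_)
open import Data.Maybe using (Maybe; just; nothing; fromMaybe)
import Data.Maybe
open import Data.List using (List; take; map)
import Data.List as L
open import Data.Product using (Σ; ∃; _×_; _,_; proj₁; proj₂)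
open import Data.Sum using (_⊎_)
open import Relation.Binary.PropositionalEquality using (_≡_; _≢_)
open import Relation.Nullary using (¬_)
open import Function.Definitions using (Injective)

record Graph : Set where
  field
    n : ℕ
    m : ℕ
    ends : Fin m → Fin n × Fin n

  Joins : Fin m → Fin n → Fin n → Set
  Joins e u w = (proj₁ (ends e) ≡ u × proj₂ (ends e) ≡ w)
              ⊎ (proj₁ (ends e) ≡ w × proj₂ (ends e) ≡ u)

  field
    loopless : ∀ e → proj₁ (ends e) ≢ proj₂ (ends e)
    noParallel : ∀ e e' u w → Joins e u w → Joins e' u w → e ≡ e'

  HasEndIn : Fin m → Subset n → Set
  HasEndIn e S = proj₁ (ends e) ∈ S ⊎ proj₂ (ends e) ∈ S

  data Reach : Fin n → Fin n → Set where
    here : ∀ {u} → Reach u u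
    step : ∀ {u v w} (e : Fin m) → Joins e u v → Reach v w → Reach u w

  Connected : Set
  Connected = ∀ u w → Reach u w

  -- successor modulo k on Fin k (the last index wraps to 0)
  next : ∀ {k} → Fin k → Maybe (Fin k)
  next {suc zero} fz = nothing
  next {suc (suc k)} fz = just (fs fz)
  next {suc (suc k)} (fs i) = Data.Maybe.map fs (next i)

  sucMod : ∀ {k} → Fin k → Fin k
  sucMod {suc k} i = fromMaybe fz (next i)

  record CycleIn (F : Subset m) : Set where
    field
      len : ℕ
      len≥3 : 3 ≤ len
      vs : Fin len → Fin n
      vs-inj : Injective _≡_ _≡_ vs
      es : Fin len → Fin m
      es∈F : ∀ j → es j ∈ F
      es-join : ∀ j → Joins (es j) (vs j) (vs (sucMod j))

  Acyclic : Subset m → Set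
  Acyclic F = ¬ CycleIn F

  Admissible : Subset n → Subset m → Set
  Admissible S F = Acyclic F × (∀ e → e ∈ F → HasEndIn e S)

  IsFValue : Subset n → ℕ → Set
  IsFValue S k = (Σ (Subset m) λ F → Admissible S F × ∣ F ∣ ≡ k)
               × (∀ F → Admissible S F → ∣ F ∣ ≤ k)

prefixSet : ∀ {n l} → (Fin l → Fin n) → ℕ → Subset n
prefixSet i k = ⋃ (take k (map ⁅_⁆ (L.tabulate i)))

module Submission where

-- Let the edge e join i_r (0-based stage r) and x, with
-- e ∈ S_{r+1} \ S_r, and suppose rank x ≤ r + 1.  Ranks 1,…,l belong to the
-- greedily chosen vertices, so x = i_s for some s ≤ r.
--   * s = r: then e joins i_r to itself, impossible in a loopless graph.
--   * s < r: then x ∈ W_r, so e has an endpoint in W_r, and S_r ∪ {e} is an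
--     acyclic (it lies inside S_{r+1}) edge set all of whose edges meet W_r.
--     It has f(W_r) + 1 edges, contradicting the maximality defining f(W_r).

open import Defs
open import Data.Nat using (ℕ; zero; suc; _≤_; _<_)
open import Data.Fin using (Fin; toℕ)
open import Data.Fin.Subset using (Subset; _∈_; _∉_; _∪_; ⁅_⁆; ∣_∣; ⊤; ⊥; _⊆_)
open import Data.Product using (_×_)
open import Relation.Binary.PropositionalEquality using (_≡_)
open import Function.Definitions using (Injective)
open import Function using (_∘_)

open import Data.Nat using (s≤s; s≤s⁻¹; _<?_)
open import Data.Nat.Properties using (<-≤-trans; ≤-<-trans; <⇒≤; ≮⇒≥; m≤n⇒m<n∨m≡n; <-irrefl)
open import Data.Fin using (fromℕ<) renaming (zero to fz; suc to fs)
open import Data.Fin.Properties using (toℕ<n; toℕ-fromℕ<; toℕ-injective)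
open import Data.Fin.Subset.Properties using (p⊆p∪q; q⊆p∪q; x∈p∪q⁻; x∈⁅x⁆; x∈⁅y⁆⇒x≡y; p⊂q⇒∣p∣<∣q∣)
open import Data.Product using (Σ; _,_; proj₁)
open import Data.Sum using (inj₁; inj₂; [_,_]′)
open import Data.Empty using (⊥-elim)
open import Relation.Binary.PropositionalEquality using (refl; sym; trans; cong; subst)
open import Relation.Nullary using (¬_; yes; no)

prefix∈ : ∀ {n l} (i : Fin l → Fin n) (s : Fin l) (k : ℕ) →
          toℕ s < k → i s ∈ prefixSet i k
prefix∈ {l = suc l} i fz     (suc k) _       = p⊆p∪q _ (x∈⁅x⁆ (i fz))
prefix∈ {l = suc l} i (fs s) (suc k) (s≤s p) =
  q⊆p∪q ⁅ i fz ⁆ _ (prefix∈ (λ z → i (fs z)) s k p)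

low-rank-is-chosen : ∀ {n l} (i : Fin l → Fin n) (rank : Fin n → ℕ) →
  Injective _≡_ _≡_ rank → (∀ v → 1 ≤ rank v) →
  (∀ s → rank (i s) ≡ suc (toℕ s)) →
  (r : Fin l) (x : Fin n) → rank x ≤ suc (toℕ r) →
  Σ (Fin l) λ s → toℕ s ≤ toℕ r × x ≡ i s
low-rank-is-chosen i rank rank-inj rank-pos rank-i r x le
  with rank x in rank-x | rank-pos x
... | suc s | _ = s' , s'≤r , rank-inj rank-x≡rank-is'
  where
  s≤r : s ≤ toℕ r
  s≤r = s≤s⁻¹ le

  s<l : s < _
  s<l = ≤-<-trans s≤r (toℕ<n r)

  s' : Fin _
  s' = fromℕ< s<l

  s'≤r : toℕ s' ≤ toℕ r
  s'≤r = subst (_≤ toℕ r) (sym (toℕ-fromℕ< s<l)) s≤r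

  rank-x≡rank-is' : rank x ≡ rank (i s')
  rank-x≡rank-is' = trans rank-x (sym (trans (rank-i s') (cong suc (toℕ-fromℕ< s<l))))

∪-⊆ : ∀ {k} {F F' : Subset k} {e : Fin k} → F ⊆ F' → e ∈ F' → F ∪ ⁅ e ⁆ ⊆ F'
∪-⊆ {F = F} {F'} {e} F⊆F' e∈F' d∈ =
  [ F⊆F' , (λ d∈⁅e⁆ → subst (_∈ F') (sym (x∈⁅y⁆⇒x≡y e d∈⁅e⁆)) e∈F') ]′ (x∈p∪q⁻ F ⁅ e ⁆ d∈)

module _ (G : Graph) where
  open Graph G

  acyclic-⊆ : {F F' : Subset m} → F ⊆ F' → Acyclic F' → Acyclic F
  acyclic-⊆ F⊆F' acyclic c = acyclic record
    { len = len ; len≥3 = len≥3 ; vs = vs ; vs-inj = vs-inj ; es = es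
    ; es∈F = λ j → F⊆F' (es∈F j) ; es-join = es-join }
    where open CycleIn c

  joins-meets : {e : Fin m} {u x : Fin n} {W : Subset n} → Joins e u x → x ∈ W → HasEndIn e W
  joins-meets (inj₁ (_ , e₂≡x)) x∈W = inj₂ (subst (_∈ _) (sym e₂≡x) x∈W)
  joins-meets (inj₂ (e₁≡x , _)) x∈W = inj₁ (subst (_∈ _) (sym e₁≡x) x∈W)

  joins-distinct : {e : Fin m} {u x : Fin n} → Joins e u x → ¬ u ≡ x
  joins-distinct (inj₁ (e₁≡u , e₂≡x)) u≡x = loopless _ (trans e₁≡u (trans u≡x (sym e₂≡x)))
  joins-distinct (inj₂ (e₁≡x , e₂≡u)) u≡x = loopless _ (trans e₁≡x (trans (sym u≡x) (sym e₂≡u)))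

  maximal-admissible : {W : Subset n} {k : ℕ} {F : Subset m} {e : Fin m} → IsFValue W k →
    (∀ e' → e' ∈ F → HasEndIn e' W) → ∣ F ∣ ≡ k →
    e ∉ F → HasEndIn e W → ¬ Acyclic (F ∪ ⁅ e ⁆)
  maximal-admissible {W} {k} {F} {e} (_ , bound) F-meets ∣F∣≡k e∉F e-meets acyclic =
    <-irrefl refl (<-≤-trans k<∣F+e∣ (bound (F ∪ ⁅ e ⁆) (acyclic , meets)))
    where
    meets : ∀ e' → e' ∈ F ∪ ⁅ e ⁆ → HasEndIn e' W
    meets e' e'∈ = [ F-meets e'
                   , (λ e'∈⁅e⁆ → subst (λ z → HasEndIn z W) (sym (x∈⁅y⁆⇒x≡y e e'∈⁅e⁆)) e-meets) ]′
                   (x∈p∪q⁻ F ⁅ e ⁆ e'∈)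

    k<∣F+e∣ : k < ∣ F ∪ ⁅ e ⁆ ∣
    k<∣F+e∣ = subst (_< _) ∣F∣≡k
      (p⊂q⇒∣p∣<∣q∣ (p⊆p∪q ⁅ e ⁆ , e , q⊆p∪q F ⁅ e ⁆ (x∈⁅x⁆ e) , e∉F))

lemma2 : (G : Graph) → let open Graph G in
    Connected →
    (f : Subset n → ℕ) → (∀ S → IsFValue S (f S)) →
    (l : ℕ) (i : Fin l → Fin n) →
    (∀ (r : Fin l) → f (prefixSet i (toℕ r)) < f ⊤) →
    (∀ (r : Fin l) → i r ∉ prefixSet i (toℕ r)) →
    (∀ (r : Fin l) (j : Fin n) → j ∉ prefixSet i (toℕ r) →
    f (prefixSet i (toℕ r) ∪ ⁅ j ⁆) ≤ f (prefixSet i (suc (toℕ r)))) →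
    f (prefixSet i l) ≡ f ⊤ →
    (S : ℕ → Subset m) →
    S 0 ≡ ⊥ →
    (∀ k → k < l → S k ⊆ S (suc k)) →
    (∀ k → k ≤ l → Acyclic (S k)) →
    (∀ k → k ≤ l → ∣ S k ∣ ≡ f (prefixSet i k)) →
    (∀ k → k ≤ l → ∀ e → e ∈ S k → HasEndIn e (prefixSet i k)) →
    (rank : Fin n → ℕ) → Injective _≡_ _≡_ rank →
    (∀ v → 1 ≤ rank v × rank v ≤ n) →
    (∀ (r : Fin l) → rank (i r) ≡ suc (toℕ r)) →
    ∀ (r : Fin l) (e : Fin m) (x : Fin n) →
    e ∈ S (suc (toℕ r)) → e ∉ S (toℕ r) → Joins e (i r) x →
    suc (toℕ r) < rank x
lemma2 G _ f f-value l i _ _ _ _ S _ S-mono S-acyclic S-card S-meets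
       rank rank-inj rank-bounds rank-i r e x e∈S[r+1] e∉S[r] e-joins
  with suc (toℕ r) <? rank x
... | yes r+1<rank = r+1<rank
... | no r+1≮rank
  with low-rank-is-chosen i rank rank-inj (proj₁ ∘ rank-bounds) rank-i r x (≮⇒≥ r+1≮rank)
... | s , s≤r , x≡is with m≤n⇒m<n∨m≡n s≤r
...   | inj₂ s≡r = ⊥-elim (joins-distinct G e-joins
                       (sym (trans x≡is (cong i (toℕ-injective s≡r)))))
...   | inj₁ s<r = ⊥-elim (maximal-admissible G (f-value W)
                       (S-meets (toℕ r) r≤l) (S-card (toℕ r) r≤l) e∉S[r]
                       (joins-meets G e-joins x∈W)
                       (acyclic-⊆ G (∪-⊆ (S-mono (toℕ r) (toℕ<n r)) e∈S[r+1])
                                    (S-acyclic (suc (toℕ r)) (toℕ<n r))))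
  where
  open Graph G
  W : Subset n
  W = prefixSet i (toℕ r)

  r≤l : toℕ r ≤ l
  r≤l = <⇒≤ (toℕ<n r)

  x∈W : x ∈ W
  x∈W = subst (_∈ W) (sym x≡is) (prefix∈ i s (toℕ r) s<r)
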